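{- Let $R$ be a commutative ring, $A,B$ finite $R$-modules with $A\neq0$, $C$ a finite cyclic group, and $\lambda:A\times B\to C$ a $\mathbb{Z}$-bilinear, $R$-balanced, non-degenerate pairing; let $\mathcal{H}=\mathcal{H}(A,B,C,\lambda)$. Then for every $\phi\in\mathrm{Aut}^0_R(\mathcal{H})$ the induced map $\bar\phi$ lies in $\mathrm{Sp}_R(A\oplus B;\delta)$, and $\bar\Theta:\mathrm{Out}^0_R(\mathcal{H})\to\mathrm{Sp}_R(A\oplus B;\delta)$, $\hat\phi\mapsto\bar\phi$, is a well-defined group homomorphism.
   Context: $\mathcal{H}(A,B,C,\lambda)$ is the set $A\times B\times C$ with elements $h(a,b,c)$ and multiplication $h(a,b,c)h(a',b',c')=h(a+a',b+b',c+c'+\lambda(a,b'))$; under the hypotheses its centre is $Z=h(0,0,C)$ and $\mathcal{H}/Z$ is identified with $A\oplus B$ via $h(a,b,c)\mapsto(a,b)$. For $\phi\in\mathrm{Aut}(\mathcal{H})$, $\bar\phi$ is the induced automorphism of $A\oplus B$. $\mathrm{Aut}^0_R(\mathcal{H})$ is the group of automorphisms fixing $Z$ elementwise with $\bar\phi$ $R$-linear; $\mathrm{Out}^0_R(\mathcal{H})=\mathrm{Aut}^0_R(\mathcal{H})/\mathrm{Inn}(\mathcal{H})$, and $\hat\phi$ is the class of $\phi$. $\delta((a,b),(a',b'))=\lambda(a,b')-\lambda(a',b)$, and $\mathrm{Sp}_R(A\oplus B;\delta)$ is the group of $R$-linear automorphisms of $A\oplus B$ preserving $\delta$. -}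

module Defs where

open import Level using (Level; _⊔_)
open import Data.Nat using (ℕ; zero; suc)
open import Data.Integer using (ℤ; +_; -[1+_])
open import Data.Fin using (Fin)
open import Data.Product using (Σ; ∃; ∃-syntax; _×_; _,_; proj₁; proj₂)
open import Relation.Binary.Core using (Rel)
open import Algebra.Bundles using (CommutativeRing; AbelianGroup)
open import Algebra.Module.Bundles using (Module)

Finite : ∀ {a ℓ} (X : Set a) → Rel X ℓ → Set (a ⊔ ℓ)
Finite X _≈_ = ∃[ n ] Σ (Fin n → X) (λ f → ∀ x → ∃[ i ] (f i ≈ x))

module Powers {c ℓ} (G : AbelianGroup c ℓ) where
  open AbelianGroup G
  powℕ : Carrier → ℕ → Carrier
  powℕ g zero = ε
  powℕ g (suc n) = g ∙ powℕ g n
  pow : Carrier → ℤ → Carrier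
  pow g (+ n) = powℕ g n
  pow g -[1+ n ] = (powℕ g (suc n)) ⁻¹

Cyclic : ∀ {c ℓ} → AbelianGroup c ℓ → Set (c ⊔ ℓ)
Cyclic G = ∃[ g ] (∀ x → ∃[ k ] (x ≈ pow g k))
  where open AbelianGroup G
        open Powers G

-- The Heisenberg-type group H(A,B,C,λ).  The group C is written
-- multiplicatively (stdlib AbelianGroup: _∙_, ε, _⁻¹); the paper writes it additively.
module Heisenberg {r ℓr a ℓa b ℓb c ℓc}
  (R : CommutativeRing r ℓr) (MA : Module R a ℓa) (MB : Module R b ℓb)
  (C : AbelianGroup c ℓc) (λ' : Module.Carrierᴹ MA → Module.Carrierᴹ MB → AbelianGroup.Carrier C) where

  private
    module RR = CommutativeRing R
    module A = Module MA
    module B = Module MB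
    module CC = AbelianGroup C

  λ-Congruent : Set _
  λ-Congruent = ∀ {x x' y y'} → x A.≈ᴹ x' → y B.≈ᴹ y' → λ' x y CC.≈ λ' x' y'

  Bilinear : Set _
  Bilinear = (∀ x x' y → λ' (x A.+ᴹ x') y CC.≈ (λ' x y CC.∙ λ' x' y))
           × (∀ x y y' → λ' x (y B.+ᴹ y') CC.≈ (λ' x y CC.∙ λ' x y'))

  Balanced : Set _
  Balanced = ∀ (s : RR.Carrier) x y → λ' (s A.*ₗ x) y CC.≈ λ' x (s B.*ₗ y)

  NonDegenerate : Set _
  NonDegenerate = (∀ x → (∀ y → λ' x y CC.≈ CC.ε) → x A.≈ᴹ A.0ᴹ)
                × (∀ y → (∀ x → λ' x y CC.≈ CC.ε) → y B.≈ᴹ B.0ᴹ)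

  H : Set (a ⊔ b ⊔ c)
  H = A.Carrierᴹ × B.Carrierᴹ × CC.Carrier

  infix 4 _≈H_
  _≈H_ : H → H → Set (ℓa ⊔ ℓb ⊔ ℓc)
  (x , y , z) ≈H (x' , y' , z') = (x A.≈ᴹ x') × (y B.≈ᴹ y') × (z CC.≈ z')

  infixl 7 _·_
  _·_ : H → H → H
  (x , y , z) · (x' , y' , z') = (x A.+ᴹ x' , y B.+ᴹ y' , (z CC.∙ z') CC.∙ λ' x y')

  invH : H → H
  invH (x , y , z) = (A.-ᴹ x , B.-ᴹ y , (z CC.⁻¹) CC.∙ λ' x y)

  inn : H → H → H
  inn g h = (g · h) · invH g

  zH : CC.Carrier → H
  zH z = (A.0ᴹ , B.0ᴹ , z)

  record IsAutH (φ : H → H) : Set (a ⊔ b ⊔ c ⊔ ℓa ⊔ ℓb ⊔ ℓc) where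
    field
      cong    : ∀ {h h'} → h ≈H h' → φ h ≈H φ h'
      hom     : ∀ h h' → φ (h · h') ≈H φ h · φ h'
      inverse : H → H
      inverse-cong : ∀ {h h'} → h ≈H h' → inverse h ≈H inverse h'
      inverseˡ : ∀ h → φ (inverse h) ≈H h
      inverseʳ : ∀ h → inverse (φ h) ≈H h

  -- A ⊕ B  (identified with H/Z via h(a,b,c) ↦ (a,b))
  AB : Set (a ⊔ b)
  AB = A.Carrierᴹ × B.Carrierᴹ

  infix 4 _≈AB_
  _≈AB_ : AB → AB → Set (ℓa ⊔ ℓb)
  (x , y) ≈AB (x' , y') = (x A.≈ᴹ x') × (y B.≈ᴹ y')

  _+AB_ : AB → AB → AB
  (x , y) +AB (x' , y') = (x A.+ᴹ x' , y B.+ᴹ y')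

  _*AB_ : RR.Carrier → AB → AB
  s *AB (x , y) = (s A.*ₗ x , s B.*ₗ y)

  δ : AB → AB → CC.Carrier
  δ (x , y) (x' , y') = λ' x y' CC.∙ (λ' x' y) CC.⁻¹

  -- induced map on H/Z ≅ A ⊕ B: (a,b) ↦ class of φ(h(a,b,c)); we take c = 0
  bar : (H → H) → AB → AB
  bar φ (x , y) = (proj₁ (φ (x , y , CC.ε)) , proj₁ (proj₂ (φ (x , y , CC.ε))))

  IsRLinear : (AB → AB) → Set _
  IsRLinear f = (∀ {u v} → u ≈AB v → f u ≈AB f v)
              × (∀ u v → f (u +AB v) ≈AB (f u +AB f v))
              × (∀ s u → f (s *AB u) ≈AB (s *AB f u))

  IsSp : (AB → AB) → Set _
  IsSp f = IsRLinear f
         × (Σ (AB → AB) λ g → (∀ {u v} → u ≈AB v → g u ≈AB g v)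
                            × (∀ u → f (g u) ≈AB u) × (∀ u → g (f u) ≈AB u))
         × (∀ u v → δ (f u) (f v) CC.≈ δ u v)

  IsAut⁰ : (H → H) → Set _
  IsAut⁰ φ = IsAutH φ × (∀ z → φ (zH z) ≈H zH z) × IsRLinear (bar φ)

  -- φ and ψ have the same class in Out⁰_R(H) = Aut⁰_R(H)/Inn(H): φ = ψ ∘ inn g
  SameOuterClass : (H → H) → (H → H) → Set _
  SameOuterClass φ ψ = ∃[ g ] (∀ h → φ h ≈H ψ (inn g h))

  _≗AB_ : (AB → AB) → (AB → AB) → Set _
  f ≗AB g = ∀ u → f u ≈AB g u

{-# OPTIONS --safe #-}
module Submission where

open import Defs
open import Level using (_⊔_)
open import Data.Product using (_×_; _,_; proj₂)
open import Data.Product.Relation.Binary.Pointwise.NonDependent using (×-setoid)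
open import Function using (_∘_)
open import Relation.Nullary using (¬_)
open import Relation.Binary.Bundles using (Setoid)
open import Algebra.Bundles using (CommutativeRing; AbelianGroup)
open import Algebra.Module.Bundles using (Module)
import Algebra.Properties.AbelianGroup as AbelianGroupProperties
import Algebra.Properties.CommutativeSemigroup as CommutativeSemigroupProperties
import Relation.Binary.Reasoning.Setoid as SetoidReasoning

-- Every φ ∈ Aut⁰(H) is a homomorphism fixing the centre Z pointwise, so it
-- descends to bar φ on H/Z = A ⊕ B, and the projection π : H → A ⊕ B satisfies
-- π ∘ φ = bar φ ∘ π.  Commutators in H are central: h h' = h' h · δ(π h, π h').
-- Applying φ to this identity and cancelling shows that bar φ preserves δ; the
-- inverse automorphism descends to the inverse of bar φ.  Inner automorphisms
-- act trivially on H/Z, which makes bar constant on outer classes.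

module HeisenbergProperties {r ℓr a ℓa b ℓb c ℓc}
    (R : CommutativeRing r ℓr) (MA : Module R a ℓa) (MB : Module R b ℓb)
    (C : AbelianGroup c ℓc)
    (λ' : Module.Carrierᴹ MA → Module.Carrierᴹ MB → AbelianGroup.Carrier C)
    (λ-cong : Heisenberg.λ-Congruent R MA MB C λ')
    (λ-additiveʳ : ∀ x y y' → AbelianGroup._≈_ C (λ' x (Module._+ᴹ_ MB y y'))
                                                 (AbelianGroup._∙_ C (λ' x y) (λ' x y')))
    where

  open Heisenberg R MA MB C λ'
  private
    module A = Module MA
    module B = Module MB
    module CC = AbelianGroup C
  open AbelianGroupProperties C using (∙-cancelˡ; ∙-cancelʳ)
  open CommutativeSemigroupProperties CC.commutativeSemigroup using (interchange)

  H-setoid : Setoid _ _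
  H-setoid = ×-setoid A.≈ᴹ-setoid (×-setoid B.≈ᴹ-setoid CC.setoid)

  AB-setoid : Setoid _ _
  AB-setoid = ×-setoid A.≈ᴹ-setoid B.≈ᴹ-setoid

  private
    module HS = Setoid H-setoid
    module ABS = Setoid AB-setoid

  ·-cong : ∀ {h₁ h₁' h₂ h₂'} → h₁ ≈H h₁' → h₂ ≈H h₂' → h₁ · h₂ ≈H h₁' · h₂'
  ·-cong (p , q , s) (p' , q' , s') =
    A.+ᴹ-cong p p' , B.+ᴹ-cong q q' , CC.∙-cong (CC.∙-cong s s') (λ-cong p q')

  λ-zeroʳ : ∀ x → λ' x B.0ᴹ CC.≈ CC.ε
  λ-zeroʳ x = CC.sym (∙-cancelˡ (λ' x B.0ᴹ) CC.ε (λ' x B.0ᴹ) (begin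
    λ' x B.0ᴹ CC.∙ CC.ε            ≈⟨ CC.identityʳ _ ⟩
    λ' x B.0ᴹ                      ≈⟨ λ-cong A.≈ᴹ-refl (B.≈ᴹ-sym (B.+ᴹ-identityʳ B.0ᴹ)) ⟩
    λ' x (B.0ᴹ B.+ᴹ B.0ᴹ)          ≈⟨ λ-additiveʳ x B.0ᴹ B.0ᴹ ⟩
    λ' x B.0ᴹ CC.∙ λ' x B.0ᴹ       ∎))
    where open SetoidReasoning CC.setoid

  π : H → AB
  π (x , y , _) = x , y

  σ : AB → H
  σ (x , y) = x , y , CC.ε

  π-cong : ∀ {h h'} → h ≈H h' → π h ≈AB π h'
  π-cong (p , q , _) = p , q

  π-·-zH : ∀ h z → π (h · zH z) ≈AB π h
  π-·-zH _ _ = A.+ᴹ-identityʳ _ , B.+ᴹ-identityʳ _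

  split-centre : ∀ h → h ≈H σ (π h) · zH (proj₂ (proj₂ h))
  split-centre (x , y , z) =
    A.≈ᴹ-sym (A.+ᴹ-identityʳ x) , B.≈ᴹ-sym (B.+ᴹ-identityʳ y) ,
    CC.sym (CC.trans (CC.∙-cong (CC.identityˡ z) (λ-zeroʳ x)) (CC.identityʳ z))

  ·-zH-cancelˡ : ∀ k {d d'} → k · zH d ≈H k · zH d' → d CC.≈ d'
  ·-zH-cancelˡ (_ , _ , z) (_ , _ , s) = ∙-cancelˡ z _ _ (∙-cancelʳ _ _ _ s)

  commute-up-to-δ : ∀ h h' → h · h' ≈H (h' · h) · zH (δ (π h) (π h'))
  commute-up-to-δ (x , y , z) (x' , y' , z') =
    A.≈ᴹ-trans (A.+ᴹ-comm x x') (A.≈ᴹ-sym (A.+ᴹ-identityʳ _)) ,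
    B.≈ᴹ-trans (B.+ᴹ-comm y y') (B.≈ᴹ-sym (B.+ᴹ-identityʳ _)) ,
    CC.sym (begin
      (((z' CC.∙ z) CC.∙ p) CC.∙ (q CC.∙ p CC.⁻¹)) CC.∙ λ' (x' A.+ᴹ x) B.0ᴹ
        ≈⟨ CC.∙-cong CC.refl (λ-zeroʳ _) ⟩
      (((z' CC.∙ z) CC.∙ p) CC.∙ (q CC.∙ p CC.⁻¹)) CC.∙ CC.ε
        ≈⟨ CC.identityʳ _ ⟩
      ((z' CC.∙ z) CC.∙ p) CC.∙ (q CC.∙ p CC.⁻¹)
        ≈⟨ interchange (z' CC.∙ z) p q (p CC.⁻¹) ⟩
      ((z' CC.∙ z) CC.∙ q) CC.∙ (p CC.∙ p CC.⁻¹)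
        ≈⟨ CC.∙-cong CC.refl (CC.inverseʳ p) ⟩
      ((z' CC.∙ z) CC.∙ q) CC.∙ CC.ε
        ≈⟨ CC.identityʳ _ ⟩
      (z' CC.∙ z) CC.∙ q
        ≈⟨ CC.∙-cong (CC.comm z' z) CC.refl ⟩
      (z CC.∙ z') CC.∙ q ∎)
    where
    open SetoidReasoning CC.setoid
    p = λ' x' y
    q = λ' x y'

  π-inn : ∀ g h → π (inn g h) ≈AB π h
  π-inn (gx , gy , _) (x , y , _) =
    AbelianGroupProperties.xyx⁻¹≈y A.+ᴹ-abelianGroup gx x ,
    AbelianGroupProperties.xyx⁻¹≈y B.+ᴹ-abelianGroup gy y

  record IsZFixingHom (φ : H → H) : Set (a ⊔ b ⊔ c ⊔ ℓa ⊔ ℓb ⊔ ℓc) where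
    field
      cong     : ∀ {h h'} → h ≈H h' → φ h ≈H φ h'
      hom      : ∀ h h' → φ (h · h') ≈H φ h · φ h'
      fixes-Z  : ∀ z → φ (zH z) ≈H zH z

  aut⁰⇒isZFixingHom : ∀ {φ} → IsAut⁰ φ → IsZFixingHom φ
  aut⁰⇒isZFixingHom (aut , fixes-Z , _) = record
    { cong = IsAutH.cong aut ; hom = IsAutH.hom aut ; fixes-Z = fixes-Z }

  inverse-isZFixingHom : ∀ {φ} (aut : IsAutH φ) → (∀ z → φ (zH z) ≈H zH z) →
                         IsZFixingHom (IsAutH.inverse aut)
  inverse-isZFixingHom {φ} aut fixes-Z = record
    { cong = inverse-cong ; hom = inverse-hom ; fixes-Z = inverse-fixes-Z }
    where
    open IsAutH aut
    inverse-hom : ∀ h h' → inverse (h · h') ≈H inverse h · inverse h'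
    inverse-hom h h' = begin
      inverse (h · h')                            ≈⟨ inverse-cong (·-cong (inverseˡ h) (inverseˡ h')) ⟨
      inverse (φ (inverse h) · φ (inverse h'))    ≈⟨ inverse-cong (hom _ _) ⟨
      inverse (φ (inverse h · inverse h'))        ≈⟨ inverseʳ _ ⟩
      inverse h · inverse h'                      ∎
      where open SetoidReasoning H-setoid
    inverse-fixes-Z : ∀ z → inverse (zH z) ≈H zH z
    inverse-fixes-Z z = HS.trans (inverse-cong (HS.sym (fixes-Z z))) (inverseʳ _)

  module _ {φ : H → H} (φ-hom : IsZFixingHom φ) where
    open IsZFixingHom φ-hom

    bar-cong : ∀ {u v} → u ≈AB v → bar φ u ≈AB bar φ v
    bar-cong (p , q) = π-cong (cong (p , q , CC.refl))

    π-natural : ∀ h → π (φ h) ≈AB bar φ (π h)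
    π-natural h@(_ , _ , z) = begin
      π (φ h)                        ≈⟨ π-cong (cong (split-centre h)) ⟩
      π (φ (σ (π h) · zH z))         ≈⟨ π-cong (hom _ _) ⟩
      π (φ (σ (π h)) · φ (zH z))     ≈⟨ π-cong (·-cong (HS.refl {φ (σ (π h))}) (fixes-Z z)) ⟩
      π (φ (σ (π h)) · zH z)         ≈⟨ π-·-zH (φ (σ (π h))) z ⟩
      π (φ (σ (π h)))                ∎
      where open SetoidReasoning AB-setoid

    bar-preserves-δ : ∀ u v → δ (bar φ u) (bar φ v) CC.≈ δ u v
    bar-preserves-δ u v = CC.sym (·-zH-cancelˡ (φ (σ v · σ u)) (begin
      φ (σ v · σ u) · zH (δ u v)                          ≈⟨ ·-cong HS.refl (fixes-Z _) ⟨
      φ (σ v · σ u) · φ (zH (δ u v))                      ≈⟨ hom _ _ ⟨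
      φ ((σ v · σ u) · zH (δ u v))                        ≈⟨ cong (commute-up-to-δ (σ u) (σ v)) ⟨
      φ (σ u · σ v)                                       ≈⟨ hom _ _ ⟩
      φ (σ u) · φ (σ v)                                   ≈⟨ commute-up-to-δ (φ (σ u)) (φ (σ v)) ⟩
      (φ (σ v) · φ (σ u)) · zH (δ (bar φ u) (bar φ v))    ≈⟨ ·-cong (hom _ _) HS.refl ⟨
      φ (σ v · σ u) · zH (δ (bar φ u) (bar φ v))          ∎))
      where open SetoidReasoning H-setoid

    bar-∘ : ∀ ψ → bar (φ ∘ ψ) ≗AB (bar φ ∘ bar ψ)
    bar-∘ ψ u = π-natural (ψ (σ u))

    bar-inverseʳ : ∀ {ψ} → (∀ h → φ (ψ h) ≈H h) → ∀ u → bar φ (bar ψ u) ≈AB u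
    bar-inverseʳ {ψ} φ∘ψ≈id u = ABS.trans (ABS.sym (bar-∘ ψ u)) (π-cong (φ∘ψ≈id (σ u)))

  bar-isSp : ∀ {φ} → IsAut⁰ φ → IsSp (bar φ)
  bar-isSp {φ} aut⁰@(aut , fixes-Z , linear) =
    linear ,
    (bar inverse , bar-cong inverse-hom ,
     bar-inverseʳ φ-hom inverseˡ , bar-inverseʳ inverse-hom inverseʳ) ,
    bar-preserves-δ φ-hom
    where
    open IsAutH aut using (inverse; inverseˡ; inverseʳ)
    φ-hom : IsZFixingHom φ
    φ-hom = aut⁰⇒isZFixingHom aut⁰
    inverse-hom : IsZFixingHom inverse
    inverse-hom = inverse-isZFixingHom aut fixes-Z

  bar-outer-invariant : ∀ {φ ψ} → IsZFixingHom ψ → SameOuterClass φ ψ → bar φ ≗AB bar ψ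
  bar-outer-invariant {φ} {ψ} ψ-hom (g , φ≈ψ∘inn) u = begin
    π (φ (σ u))             ≈⟨ π-cong (φ≈ψ∘inn (σ u)) ⟩
    π (ψ (inn g (σ u)))     ≈⟨ π-natural ψ-hom (inn g (σ u)) ⟩
    bar ψ (π (inn g (σ u))) ≈⟨ bar-cong ψ-hom (π-inn g (σ u)) ⟩
    bar ψ u                 ∎
    where open SetoidReasoning AB-setoid

proposition6p1 : ∀ {r ℓr a ℓa b ℓb c ℓc}
    (R : CommutativeRing r ℓr) (MA : Module R a ℓa) (MB : Module R b ℓb)
    (C : AbelianGroup c ℓc)
    (λ' : Module.Carrierᴹ MA → Module.Carrierᴹ MB → AbelianGroup.Carrier C) →
    let open Heisenberg R MA MB C λ' in
    Finite (Module.Carrierᴹ MA) (Module._≈ᴹ_ MA) →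
    Finite (Module.Carrierᴹ MB) (Module._≈ᴹ_ MB) →
    ¬ (∀ x → Module._≈ᴹ_ MA x (Module.0ᴹ MA)) →
    Finite (AbelianGroup.Carrier C) (AbelianGroup._≈_ C) →
    Cyclic C →
    λ-Congruent → Bilinear → Balanced → NonDegenerate →
    (∀ φ → IsAut⁰ φ → IsSp (bar φ))
    × (∀ φ ψ → IsAut⁰ φ → IsAut⁰ ψ → SameOuterClass φ ψ → bar φ ≗AB bar ψ)
    × (∀ φ ψ → IsAut⁰ φ → IsAut⁰ ψ → bar (φ ∘ ψ) ≗AB (bar φ ∘ bar ψ))
proposition6p1 R MA MB C λ' _ _ _ _ _ λ-cong (_ , λ-additiveʳ) _ _ =
  (λ _ → bar-isSp) ,
  (λ _ _ _ ψ-aut⁰ → bar-outer-invariant (aut⁰⇒isZFixingHom ψ-aut⁰)) ,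
  (λ _ ψ φ-aut⁰ _ → bar-∘ (aut⁰⇒isZFixingHom φ-aut⁰) ψ)
  where open HeisenbergProperties R MA MB C λ' λ-cong λ-additiveʳ
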